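{- Let $F$ be a finite family of finite sets. If $F$ is an HKE set-system, then $F$ is uniform (all its members have the same cardinality). Consequently, $F$ is an HKE set-system if and only if every non-empty subfamily $\Gamma$ of $F$ is a KE set-system.
   Context: $F$ is an HKE set-system if there is a positive integer $\alpha$ such that $|\bigcup \Gamma|+|\bigcap \Gamma|=2\alpha$ for every non-empty subfamily $\Gamma\subseteq F$. For a uniform family $\Gamma$, $\alpha(\Gamma)$ denotes the common cardinality of its members; a uniform family $\Gamma$ is a KE set-system if $|\bigcup \Gamma|+|\bigcap \Gamma|=2\alpha(\Gamma)$ (in particular a KE set-system is by definition uniform). -}

module Defs where

open import Data.Nat using (ℕ; _+_; _*_; _<_)
open import Data.Fin using (Fin)
open import Data.Fin.Subset using (Subset; _∈_; ⋃; ⋂; ∣_∣; Nonempty)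
open import Data.Fin.Subset.Properties using (_∈?_)
open import Data.List using (List; map; filter)
open import Data.List using () renaming (allFin to allFinL)
open import Data.Product using (Σ; _×_)
open import Relation.Binary.PropositionalEquality using (_≡_)

-- A finite family of finite sets: m members, each a subset of the
-- finite ground set Fin n (indexed; repeated members are harmless).
Family : ℕ → ℕ → Set
Family n m = Fin m → Subset n

members : ∀ {n m} → Family n m → Subset m → List (Subset n)
members {m = m} F Γ = map F (filter (_∈? Γ) (allFinL m))

⋃F : ∀ {n m} → Family n m → Subset m → Subset n
⋃F F Γ = ⋃ (members F Γ)

⋂F : ∀ {n m} → Family n m → Subset m → Subset n
⋂F F Γ = ⋂ (members F Γ)

HKE : ∀ {n m} → Family n m → Set
HKE {m = m} F = Σ ℕ λ α → (0 < α) ×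
  ((Γ : Subset m) → Nonempty Γ → ∣ ⋃F F Γ ∣ + ∣ ⋂F F Γ ∣ ≡ 2 * α)

UniformSub : ∀ {n m} → Family n m → Subset m → Set
UniformSub F Γ = ∀ i j → i ∈ Γ → j ∈ Γ → ∣ F i ∣ ≡ ∣ F j ∣

Uniform : ∀ {n m} → Family n m → Set
Uniform F = ∀ i j → ∣ F i ∣ ≡ ∣ F j ∣

KE : ∀ {n m} → Family n m → Subset m → Set
KE F Γ = UniformSub F Γ ×
  (∀ i → i ∈ Γ → ∣ ⋃F F Γ ∣ + ∣ ⋂F F Γ ∣ ≡ 2 * ∣ F i ∣)

{-# OPTIONS --safe #-}

-- A singleton subfamily {A} has ⋃ = ⋂ = A, so the HKE condition applied to it
-- reads 2|A| = 2α: every member has cardinality α, and then the HKE condition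
-- for any Γ is exactly the KE condition. Conversely, if every non-empty
-- subfamily is KE, the whole family is uniform of some cardinality α, which
-- is positive as soon as the members are non-empty.

module Submission where

open import Defs
open import Data.Nat using (zero; suc; _+_; _*_; _<_)
open import Data.Nat.Properties using (*-cancelˡ-≡; +-identityʳ; m<n⇒0<n; 0<1+n)
open import Data.Fin using (Fin; zero; suc)
open import Data.Fin.Subset using (Subset; Side; Nonempty; ⁅_⁆; ⊥; ⊤; ⋃; ⋂; ∣_∣; inside; outside)
open import Data.Fin.Subset.Properties
  using (_∈?_; ∪-identityʳ; ∩-identityʳ; ∈⊤; x∈⁅x⁆; ∉⊥; x∈p⇒∣p-x∣<∣p∣)
open import Data.List using (List; []; _∷_; [_]; map; filter; allFin)
open import Data.List.Properties using (map-tabulate; filter-none)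
open import Data.List.Relation.Unary.All using (universal)
open import Data.Vec using (_∷_)
open import Data.Product using (_×_; _,_; proj₁; proj₂)
open import Function using (id)
open import Function.Bundles using (_⇔_; mk⇔)
open import Relation.Nullary using (yes; no)
open import Relation.Binary.PropositionalEquality
  using (_≡_; refl; sym; trans; cong; cong₂; module ≡-Reasoning)

open ≡-Reasoning

filter-∈?-map-suc : ∀ {m} (b : Side) (p : Subset m) (xs : List (Fin m)) →
  filter (_∈? b ∷ p) (map suc xs) ≡ map suc (filter (_∈? p) xs)
filter-∈?-map-suc b p [] = refl
filter-∈?-map-suc b p (x ∷ xs) with x ∈? p
... | yes _ = cong (suc x ∷_) (filter-∈?-map-suc b p xs)
... | no _  = filter-∈?-map-suc b p xs

filter-∈?-⊥ : ∀ {m} (xs : List (Fin m)) → filter (_∈? ⊥) xs ≡ []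
filter-∈?-⊥ xs = filter-none (_∈? ⊥) (universal (λ _ → ∉⊥) xs)

allFin-suc : ∀ m → allFin (suc m) ≡ zero ∷ map suc (allFin m)
allFin-suc m = cong (zero ∷_) (sym (map-tabulate id suc))

filter-∈?-⁅⁆ : ∀ {m} (i : Fin m) → filter (_∈? ⁅ i ⁆) (allFin m) ≡ [ i ]
filter-∈?-⁅⁆ {suc m} zero = begin
  filter (_∈? ⁅ zero ⁆) (allFin (suc m))        ≡⟨ cong (filter (_∈? ⁅ zero ⁆)) (allFin-suc m) ⟩
  zero ∷ filter (_∈? ⁅ zero ⁆) (map suc (allFin m)) ≡⟨ cong (zero ∷_) (filter-∈?-map-suc inside ⊥ (allFin m)) ⟩
  zero ∷ map suc (filter (_∈? ⊥) (allFin m))     ≡⟨ cong (λ xs → zero ∷ map suc xs) (filter-∈?-⊥ (allFin m)) ⟩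
  [ zero ]                                        ∎
filter-∈?-⁅⁆ {suc m} (suc i) = begin
  filter (_∈? ⁅ suc i ⁆) (allFin (suc m))       ≡⟨ cong (filter (_∈? ⁅ suc i ⁆)) (allFin-suc m) ⟩
  filter (_∈? ⁅ suc i ⁆) (map suc (allFin m))   ≡⟨ filter-∈?-map-suc outside ⁅ i ⁆ (allFin m) ⟩
  map suc (filter (_∈? ⁅ i ⁆) (allFin m))       ≡⟨ cong (map suc) (filter-∈?-⁅⁆ i) ⟩
  [ suc i ]                                     ∎

module _ {n m} (F : Family n m) where

  members-⁅⁆ : ∀ i → members F ⁅ i ⁆ ≡ [ F i ]
  members-⁅⁆ i = cong (map F) (filter-∈?-⁅⁆ i)

  ⋃F-⁅⁆ : ∀ i → ⋃F F ⁅ i ⁆ ≡ F i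
  ⋃F-⁅⁆ i = trans (cong ⋃ (members-⁅⁆ i)) (∪-identityʳ (F i))

  ⋂F-⁅⁆ : ∀ i → ⋂F F ⁅ i ⁆ ≡ F i
  ⋂F-⁅⁆ i = trans (cong ⋂ (members-⁅⁆ i)) (∩-identityʳ (F i))

  ∣⋃F-⁅⁆∣+∣⋂F-⁅⁆∣≡2*∣F∣ : ∀ i → ∣ ⋃F F ⁅ i ⁆ ∣ + ∣ ⋂F F ⁅ i ⁆ ∣ ≡ 2 * ∣ F i ∣
  ∣⋃F-⁅⁆∣+∣⋂F-⁅⁆∣≡2*∣F∣ i = begin
    ∣ ⋃F F ⁅ i ⁆ ∣ + ∣ ⋂F F ⁅ i ⁆ ∣ ≡⟨ cong₂ _+_ (cong ∣_∣ (⋃F-⁅⁆ i)) (cong ∣_∣ (⋂F-⁅⁆ i)) ⟩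
    ∣ F i ∣ + ∣ F i ∣               ≡⟨ cong (∣ F i ∣ +_) (sym (+-identityʳ ∣ F i ∣)) ⟩
    2 * ∣ F i ∣                     ∎

  HKE⇒∣F∣≡α : (hke : HKE F) → ∀ i → ∣ F i ∣ ≡ proj₁ hke
  HKE⇒∣F∣≡α (α , _ , hke) i = *-cancelˡ-≡ ∣ F i ∣ α 2
    (trans (sym (∣⋃F-⁅⁆∣+∣⋂F-⁅⁆∣≡2*∣F∣ i)) (hke ⁅ i ⁆ (i , x∈⁅x⁆ i)))

  HKE⇒Uniform : HKE F → Uniform F
  HKE⇒Uniform hke i j = trans (HKE⇒∣F∣≡α hke i) (sym (HKE⇒∣F∣≡α hke j))

  HKE⇒KE : HKE F → (Γ : Subset m) → Nonempty Γ → KE F Γ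
  HKE⇒KE hke@(_ , _ , hke-sum) Γ Γ≢∅ =
    (λ i j _ _ → HKE⇒Uniform hke i j) ,
    (λ i _ → trans (hke-sum Γ Γ≢∅) (cong (2 *_) (sym (HKE⇒∣F∣≡α hke i))))

nonempty⇒∣p∣>0 : ∀ {n} {p : Subset n} → Nonempty p → 0 < ∣ p ∣
nonempty⇒∣p∣>0 (_ , x∈p) = m<n⇒0<n (x∈p⇒∣p-x∣<∣p∣ x∈p)

KE⇒HKE : ∀ {n m} (F : Family n m) → (∀ i → Nonempty (F i)) →
  ((Γ : Subset m) → Nonempty Γ → KE F Γ) → HKE F
KE⇒HKE {m = zero} F _ _ = 1 , 0<1+n , λ { Γ (() , _) }
KE⇒HKE {m = suc m} F F≢∅ ke = ∣ F zero ∣ , nonempty⇒∣p∣>0 (F≢∅ zero) , ke-sum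
  where
  ke-sum : (Γ : Subset (suc m)) → Nonempty Γ → ∣ ⋃F F Γ ∣ + ∣ ⋂F F Γ ∣ ≡ 2 * ∣ F zero ∣
  ke-sum Γ Γ≢∅@(i , i∈Γ) = begin
    ∣ ⋃F F Γ ∣ + ∣ ⋂F F Γ ∣ ≡⟨ proj₂ (ke Γ Γ≢∅) i i∈Γ ⟩
    2 * ∣ F i ∣             ≡⟨ cong (2 *_) (proj₁ (ke ⊤ (zero , ∈⊤)) i zero ∈⊤ ∈⊤) ⟩
    2 * ∣ F zero ∣          ∎

proposition1p3 : ∀ {n m} (F : Family n m) →
    (HKE F → Uniform F) ×
    ((∀ i → Nonempty (F i)) →
      (HKE F ⇔ ((Γ : Subset m) → Nonempty Γ → KE F Γ)))
proposition1p3 F = HKE⇒Uniform F , λ F≢∅ → mk⇔ (HKE⇒KE F) (KE⇒HKE F F≢∅)
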